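{- Let $x,y\in W$ and let $\eta$ be a weight with $A_x=A_y+\eta$. Then for every $w\in W$, $A_{w^{(m)}x}=A_{wy}+\eta$, where $m=L(\eta)$.
   Context: Fix $k\ge1$; $W$ is the affine symmetric group with generators $s_0,\dots,s_k$ (indices mod $k+1$; relations $s_i^2=1$, $s_is_j=s_js_i$ for $i-j\not\equiv\pm1$, $s_is_{i+1}s_i=s_{i+1}s_is_{i+1}$). For $w=s_{i_1}\cdots s_{i_l}$, $w^{(m)}=s_{i_1+m}\cdots s_{i_l+m}$ (indices mod $k+1$). $V=\mathbb{R}^{k+1}/\mathbb{R}(1,\dots,1)$ with action: for $i\ne0$, $s_i\diamond a$ swaps coordinates $i,i+1$; $s_0\diamond(a_1,\dots,a_{k+1})=(a_{k+1}+1,a_2,\dots,a_k,a_1-1)$. Weights are images of $\mathbb{Z}^{k+1}$; the label of a weight $\eta$ is $L(\eta)=(\sum_i\eta_i)\bmod(k+1)$. $A_\emptyset=\{a:a_1\ge\dots\ge a_{k+1}\ge a_1-1\}$ and $A_w=w^{ -1}\diamond A_\emptyset$.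
   Formalization: The space V is taken over the rationals instead of the reals, so the alcoves $A_w$ and their translates by weights consist of rational points. -}

module Defs where

open import Data.Nat as ℕ using (ℕ)
open import Data.Nat.DivMod using (_%_; m%n<n)
open import Data.Fin as Fin using (Fin; zero; suc; toℕ; fromℕ<; inject₁; _≟_)
open import Data.Integer as ℤ using (ℤ)
open import Data.Integer.DivMod using (_%ℕ_)
open import Data.Rational as ℚ using (ℚ; _≤_; _+_; _-_; 1ℚ; _/_)
open import Data.List using (List; []; _∷_; map)
open import Data.Product using (_×_)
open import Relation.Nullary using (yes; no)

-- Elements of the affine symmetric group W (rank k+1) are given as words
-- in the generators s_0, …, s_k; a generator index is an element of Fin (ℕ.suc k).
Word : ℕ → Set
Word k = List (Fin (ℕ.suc k))

-- Vectors in ℚ^{k+1}, coordinates 1..k+1 are indices 0..k.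
-- (V = ℚ^{k+1} modulo constants; all predicates below are invariant under
-- adding constant vectors, so we work with representatives.)
Vect : ℕ → Set
Vect k = Fin (ℕ.suc k) → ℚ

gen : ∀ {k} → Fin (ℕ.suc k) → Vect k → Vect k
gen {k} zero a j with j ≟ zero
... | yes _ = a (Fin.fromℕ k) + 1ℚ
... | no _ with j ≟ Fin.fromℕ k
...   | yes _ = a zero - 1ℚ
...   | no _ = a j
gen (suc i) a j with j ≟ inject₁ i
... | yes _ = a (suc i)
... | no _ with j ≟ suc i
...   | yes _ = a (inject₁ i)
...   | no _ = a j

act : ∀ {k} → Word k → Vect k → Vect k
act [] a = a
act (i ∷ w) a = gen i (act w a)

InA∅ : ∀ {k} → Vect k → Set
InA∅ {k} a = (∀ (j : Fin k) → a (suc j) ≤ a (inject₁ j))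
           × (a zero - 1ℚ ≤ a (Fin.fromℕ k))

-- A_w = w⁻¹ ◇ A_∅ = { a : w ◇ a ∈ A_∅ }
InAlc : ∀ {k} → Word k → Vect k → Set
InAlc w a = InA∅ (act w a)

-- weights: integer vectors (representatives)
Weight : ℕ → Set
Weight k = Fin (ℕ.suc k) → ℤ

toℚ : ℤ → ℚ
toℚ z = z / 1

AlcTransl : ∀ {k} → Word k → Word k → Weight k → Set
AlcTransl x y η = ∀ b → (InAlc x b → InAlc y (λ j → b j - toℚ (η j)))
                      × (InAlc y (λ j → b j - toℚ (η j)) → InAlc x b)

sumℤ : ∀ {n} → (Fin n → ℤ) → ℤ
sumℤ {ℕ.zero} f = ℤ.+ 0
sumℤ {ℕ.suc n} f = f zero ℤ.+ sumℤ (λ j → f (suc j))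

label : ∀ {k} → Weight k → ℕ
label {k} η = sumℤ η %ℕ ℕ.suc k

shiftIdx : ∀ {k} → ℕ → Fin (ℕ.suc k) → Fin (ℕ.suc k)
shiftIdx {k} m i = fromℕ< (m%n<n (toℕ i ℕ.+ m) (ℕ.suc k))

shiftW : ∀ {k} → ℕ → Word k → Word k
shiftW m w = map (shiftIdx m) w

module Submission where

-- Every element of W acts on V = ℚ^{k+1} as a permuted translation
-- a ↦ (l ↦ a_{π l} + d_l), with π a permutation and d an integer vector; so do
-- the rotation ρ : (a_1, …, a_{k+1}) ↦ (a_{k+1} + 1, a_1, …, a_k) of the
-- fundamental alcove and the integer translations.  The hypothesis says that
-- h = y ∘ τ_{-η} ∘ x⁻¹ maps A∅ into itself.  By the stabiliser lemma, a
-- permuted translation mapping A∅ into itself whose permutation fixes 0 is a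
-- translation along (c, …, c), i.e. acts trivially on V; it is proved by
-- testing on the integer vertices of A∅.  Applied to ρ⁻ˢ ∘ h for the right s,
-- and combined with the total shift Σ_l d_l (additive, 0 on W, 1 on ρ and
-- -Σ η on τ_{-η}), this gives s ≡ -L(η) (mod k+1).  Since ρ conjugates s_i to
-- s_{i+1}, we get the one-letter step A_{s_{i+m} x} = A_{s_i y} + η, and the
-- lemma follows by induction on w.  Coordinates are indexed 0, …, k.

open import Defs
open import Data.Nat as ℕ using (ℕ; z≤n; s≤s)
import Data.Nat.Properties as ℕP
open import Data.Fin using (Fin; zero; suc; toℕ; fromℕ; inject₁; _≟_)
import Data.Fin.Properties as FinP
open import Data.Fin.Permutation using (permutation)
open import Data.Fin.Relation.Unary.Top using (view; ‵fromℕ; ‵inj₁)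
open import Data.Nat.DivMod using (_%_; m%n<n; %-distribˡ-+; m%n%n≡m%n; n%n≡0; m<n⇒m%n≡m; [m+kn]%n≡m%n)
open import Data.Integer as ℤ using (ℤ; +_; -[1+_])
open import Data.Integer.DivMod using (_%ℕ_; _/ℕ_; a≡a%ℕn+[a/ℕn]*n)
import Data.Integer.Properties as ℤP
open import Data.Rational as ℚ using (_≤_; _+_; _-_; 1ℚ; 0ℚ)
import Data.Rational.Properties as ℚP
import Data.Rational.Unnormalised as ℚᵘ
import Data.Rational.Unnormalised.Properties as ℚᵘP
open import Data.List using ([]; _∷_; _++_)
open import Data.Product using (Σ; _×_; _,_; proj₁; proj₂)
open import Relation.Binary.PropositionalEquality
open import Relation.Nullary using (Dec; yes; no)
open import Data.Empty using (⊥-elim)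
import Algebra.Properties.CommutativeMonoid.Sum as MonoidSum
import Algebra.Properties.Group as GroupProperties
open import Algebra.Bundles using (AbelianGroup; CommutativeMonoid)
open import Data.Integer.Tactic.RingSolver using (solve-∀)

open GroupProperties ℚP.+-0-group using (//-rightDividesˡ; //-rightDividesʳ)
open import Algebra.Properties.CommutativeSemigroup (CommutativeMonoid.commutativeSemigroup ℚP.+-0-commutativeMonoid)
  using (xy∙z≈xz∙y)
module ℤG = GroupProperties (AbelianGroup.group ℤP.+-0-abelianGroup)

toℚᵘ-toℚ : ∀ z → ℚ.toℚᵘ (toℚ z) ℚᵘ.≃ ℚᵘ.mkℚᵘ z 0
toℚᵘ-toℚ z = ℚP.toℚᵘ-fromℚᵘ (ℚᵘ.mkℚᵘ z 0)

-- the numerator identity behind  a/1 + b/1 = (a + b)/1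
numerator-+ : ∀ a b → (a ℤ.+ b) ℤ.* + 1 ≡ (a ℤ.* + 1 ℤ.+ b ℤ.* + 1) ℤ.* + 1
numerator-+ = solve-∀

toℚ-+ : ∀ a b → toℚ (a ℤ.+ b) ≡ toℚ a + toℚ b
toℚ-+ a b = ℚP.toℚᵘ-injective (begin-equality
    ℚ.toℚᵘ (toℚ (a ℤ.+ b))               ≃⟨ toℚᵘ-toℚ (a ℤ.+ b) ⟩
    ℚᵘ.mkℚᵘ (a ℤ.+ b) 0                   ≃⟨ ℚᵘ.*≡* (numerator-+ a b) ⟩
    ℚᵘ.mkℚᵘ a 0 ℚᵘ.+ ℚᵘ.mkℚᵘ b 0          ≃⟨ ℚᵘP.+-cong (toℚᵘ-toℚ a) (toℚᵘ-toℚ b) ⟨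
    ℚ.toℚᵘ (toℚ a) ℚᵘ.+ ℚ.toℚᵘ (toℚ b)   ≃⟨ ℚP.toℚᵘ-homo-+ (toℚ a) (toℚ b) ⟨
    ℚ.toℚᵘ (toℚ a + toℚ b)               ∎)
  where open ℚᵘP.≤-Reasoning

toℚ-neg : ∀ z → toℚ (ℤ.- z) ≡ ℚ.- toℚ z
toℚ-neg z = ℚP.toℚᵘ-injective (begin-equality
    ℚ.toℚᵘ (toℚ (ℤ.- z))     ≃⟨ toℚᵘ-toℚ (ℤ.- z) ⟩
    ℚᵘ.mkℚᵘ (ℤ.- z) 0        ≃⟨ ℚᵘP.-‿cong (toℚᵘ-toℚ z) ⟨
    ℚᵘ.- ℚ.toℚᵘ (toℚ z)      ≃⟨ ℚP.toℚᵘ-homo‿- (toℚ z) ⟨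
    ℚ.toℚᵘ (ℚ.- toℚ z)       ∎)
  where open ℚᵘP.≤-Reasoning

toℚ-mono-≤ : ∀ {a b} → a ℤ.≤ b → toℚ a ≤ toℚ b
toℚ-mono-≤ {a} {b} a≤b = ℚP.toℚᵘ-cancel-≤ (begin
    ℚ.toℚᵘ (toℚ a)  ≃⟨ toℚᵘ-toℚ a ⟩
    ℚᵘ.mkℚᵘ a 0     ≤⟨ ℚᵘ.*≤* (ℤP.*-monoʳ-≤-nonNeg (+ 1) a≤b) ⟩
    ℚᵘ.mkℚᵘ b 0     ≃⟨ toℚᵘ-toℚ b ⟨
    ℚ.toℚᵘ (toℚ b)  ∎)
  where open ℚᵘP.≤-Reasoning

toℚ-cancel-≤ : ∀ {a b} → toℚ a ≤ toℚ b → a ℤ.≤ b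
toℚ-cancel-≤ {a} {b} p with ℚᵘP.≤-respˡ-≃ (toℚᵘ-toℚ a) (ℚᵘP.≤-respʳ-≃ (toℚᵘ-toℚ b) (ℚP.toℚᵘ-mono-≤ p))
... | ℚᵘ.*≤* q = subst₂ ℤ._≤_ (ℤP.*-identityʳ a) (ℤP.*-identityʳ b) q

toℚ-cancelʳ : ∀ x z → x + toℚ z + toℚ (ℤ.- z) ≡ x
toℚ-cancelʳ x z = begin
  x + toℚ z + toℚ (ℤ.- z)     ≡⟨ ℚP.+-assoc x _ _ ⟩
  x + (toℚ z + toℚ (ℤ.- z))   ≡⟨ cong (λ u → x + u) (toℚ-+ z (ℤ.- z)) ⟨
  x + toℚ (z ℤ.+ ℤ.- z)       ≡⟨ cong (λ u → x + toℚ u) (ℤP.+-inverseʳ z) ⟩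
  x + 0ℚ                      ≡⟨ ℚP.+-identityʳ x ⟩
  x                           ∎
  where open ≡-Reasoning

toℚ-cancelˡ : ∀ x z → x + toℚ (ℤ.- z) + toℚ z ≡ x
toℚ-cancelˡ x z = trans (cong (λ u → x + toℚ (ℤ.- z) + toℚ u) (sym (ℤP.neg-involutive z)))
                        (toℚ-cancelʳ x (ℤ.- z))

open MonoidSum ℤP.+-0-commutativeMonoid using (sum; sum-permute; sum-cong-≗; ∑-distrib-+)

sumℤ≡sum : ∀ {n} (f : Fin n → ℤ) → sumℤ f ≡ sum f
sumℤ≡sum {ℕ.zero} f = refl
sumℤ≡sum {ℕ.suc n} f = cong (λ u → f zero ℤ.+ u) (sumℤ≡sum (λ j → f (suc j)))

sumℤ-cong : ∀ {n} {f g : Fin n → ℤ} → f ≗ g → sumℤ f ≡ sumℤ g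
sumℤ-cong {f = f} {g} f≗g = trans (sumℤ≡sum f) (trans (sum-cong-≗ f≗g) (sym (sumℤ≡sum g)))

sumℤ-+ : ∀ {n} (f g : Fin n → ℤ) → sumℤ (λ l → f l ℤ.+ g l) ≡ sumℤ f ℤ.+ sumℤ g
sumℤ-+ f g = trans (sumℤ≡sum (λ l → f l ℤ.+ g l)) (trans (∑-distrib-+ f g)
               (sym (cong₂ ℤ._+_ (sumℤ≡sum f) (sumℤ≡sum g))))

sumℤ-neg : ∀ {n} (f : Fin n → ℤ) → sumℤ (λ l → ℤ.- f l) ≡ ℤ.- sumℤ f
sumℤ-neg {ℕ.zero} f = refl
sumℤ-neg {ℕ.suc n} f = trans (cong (λ u → ℤ.- f zero ℤ.+ u) (sumℤ-neg (λ j → f (suc j))))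
                             (sym (ℤP.neg-distrib-+ (f zero) _))

sumℤ-const : ∀ n c → sumℤ {n} (λ _ → c) ≡ + n ℤ.* c
sumℤ-const ℕ.zero c = sym (ℤP.*-zeroˡ c)
sumℤ-const (ℕ.suc n) c = begin
  c ℤ.+ sumℤ {n} (λ _ → c)   ≡⟨ cong (λ u → c ℤ.+ u) (sumℤ-const n c) ⟩
  c ℤ.+ + n ℤ.* c            ≡⟨ ℤP.suc-* (+ n) c ⟨
  ℤ.suc (+ n) ℤ.* c          ∎
  where open ≡-Reasoning

record PermTransl (k : ℕ) : Set where
  field
    π      : Fin (ℕ.suc k) → Fin (ℕ.suc k)
    π⁻¹    : Fin (ℕ.suc k) → Fin (ℕ.suc k)
    π⁻¹∘π  : ∀ l → π⁻¹ (π l) ≡ l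
    π∘π⁻¹  : ∀ l → π (π⁻¹ l) ≡ l
    offset : Fin (ℕ.suc k) → ℤ
open PermTransl public

module _ {k : ℕ} where

  infixr 9 _∘ᴾ_
  infix 10 _⁻¹ᴾ
  infix 4 _≈ᴾ_

  apply : PermTransl k → Vect k → Vect k
  apply F a l = a (π F l) + toℚ (offset F l)

  -- composition, so that  apply (F ∘ᴾ G) = apply F ∘ apply G
  _∘ᴾ_ : PermTransl k → PermTransl k → PermTransl k
  F ∘ᴾ G = record
    { π      = λ l → π G (π F l)
    ; π⁻¹    = λ l → π⁻¹ F (π⁻¹ G l)
    ; π⁻¹∘π  = λ l → trans (cong (π⁻¹ F) (π⁻¹∘π G (π F l))) (π⁻¹∘π F l)
    ; π∘π⁻¹  = λ l → trans (cong (π G) (π∘π⁻¹ F (π⁻¹ G l))) (π∘π⁻¹ G l)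
    ; offset = λ l → offset G (π F l) ℤ.+ offset F l }

  _⁻¹ᴾ : PermTransl k → PermTransl k
  F ⁻¹ᴾ = record
    { π = π⁻¹ F ; π⁻¹ = π F ; π⁻¹∘π = π∘π⁻¹ F ; π∘π⁻¹ = π⁻¹∘π F
    ; offset = λ l → ℤ.- offset F (π⁻¹ F l) }

  translation : (Fin (ℕ.suc k) → ℤ) → PermTransl k
  translation v = record
    { π = λ l → l ; π⁻¹ = λ l → l ; π⁻¹∘π = λ _ → refl ; π∘π⁻¹ = λ _ → refl ; offset = v }

  -- the translation along (c, …, c), i.e. the identity of V
  constant : ℤ → PermTransl k
  constant c = translation (λ _ → c)

  _≈ᴾ_ : PermTransl k → PermTransl k → Set
  F ≈ᴾ G = (π F ≗ π G) × (offset F ≗ offset G)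

  apply-≈ : ∀ F G → F ≈ᴾ G → ∀ a → apply F a ≗ apply G a
  apply-≈ _ _ (π≗ , offset≗) a l = cong₂ (λ i z → a i + toℚ z) (π≗ l) (offset≗ l)

  apply-cong : ∀ F {a b} → a ≗ b → apply F a ≗ apply F b
  apply-cong F a≗b l = cong (λ q → q + toℚ (offset F l)) (a≗b (π F l))

  apply-∘ : ∀ F G a → apply F (apply G a) ≗ apply (F ∘ᴾ G) a
  apply-∘ F G a l = begin
    a i + toℚ (offset G (π F l)) + toℚ (offset F l)
      ≡⟨ ℚP.+-assoc (a i) _ _ ⟩
    a i + (toℚ (offset G (π F l)) + toℚ (offset F l))
      ≡⟨ cong (λ q → a i + q) (toℚ-+ (offset G (π F l)) (offset F l)) ⟨
    a i + toℚ (offset G (π F l) ℤ.+ offset F l) ∎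
    where
    open ≡-Reasoning
    i : Fin (ℕ.suc k)
    i = π G (π F l)

  apply-inverseˡ : ∀ F a → apply (F ⁻¹ᴾ) (apply F a) ≗ a
  apply-inverseˡ F a l rewrite π∘π⁻¹ F l = toℚ-cancelʳ (a l) (offset F (π⁻¹ F l))

  apply-inverseʳ : ∀ F a → apply F (apply (F ⁻¹ᴾ) a) ≗ a
  apply-inverseʳ F a l rewrite π⁻¹∘π F l = toℚ-cancelˡ (a l) (offset F l)

  apply-zero : ∀ a → apply (constant (+ 0)) a ≗ a
  apply-zero a l = ℚP.+-identityʳ (a l)

  totalShift : PermTransl k → ℤ
  totalShift F = sumℤ (offset F)

  sumℤ-permute : ∀ F (f : Fin (ℕ.suc k) → ℤ) → sumℤ (λ l → f (π F l)) ≡ sumℤ f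
  sumℤ-permute F f = begin
    sumℤ (λ l → f (π F l))  ≡⟨ sumℤ≡sum (λ l → f (π F l)) ⟩
    sum (λ l → f (π F l))   ≡⟨ sum-permute f (permutation (π F) (π⁻¹ F) (π∘π⁻¹ F) (π⁻¹∘π F)) ⟨
    sum f                   ≡⟨ sumℤ≡sum f ⟨
    sumℤ f                  ∎
    where open ≡-Reasoning

  totalShift-∘ : ∀ F G → totalShift (F ∘ᴾ G) ≡ totalShift G ℤ.+ totalShift F
  totalShift-∘ F G = trans (sumℤ-+ (λ l → offset G (π F l)) (offset F))
                           (cong (ℤ._+ totalShift F) (sumℤ-permute F (offset G)))

  totalShift-⁻¹ : ∀ F → totalShift (F ⁻¹ᴾ) ≡ ℤ.- totalShift F
  totalShift-⁻¹ F = trans (sumℤ-neg (λ l → offset F (π⁻¹ F l)))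
                          (cong ℤ.-_ (sumℤ-permute (F ⁻¹ᴾ) (offset F)))

  totalShift-constant : ∀ c → totalShift (constant c) ≡ + ℕ.suc k ℤ.* c
  totalShift-constant = sumℤ-const (ℕ.suc k)

module _ {k : ℕ} where

  InA∅-resp : ∀ {a b : Vect k} → a ≗ b → InA∅ a → InA∅ b
  InA∅-resp a≗b (chain , wrap) =
    (λ j → subst₂ _≤_ (a≗b (suc j)) (a≗b (inject₁ j)) (chain j)) ,
    subst₂ _≤_ (cong (_- 1ℚ) (a≗b zero)) (a≗b (fromℕ k)) wrap

  Preserves : PermTransl k → Set
  Preserves F = ∀ a → InA∅ a → InA∅ (apply F a)

  Reflects : PermTransl k → Set
  Reflects F = ∀ a → InA∅ (apply F a) → InA∅ a

  preserves-∘ : ∀ {F G} → Preserves F → Preserves G → Preserves (F ∘ᴾ G)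
  preserves-∘ {F} {G} pF pG a a∈ = InA∅-resp (apply-∘ F G a) (pF (apply G a) (pG a a∈))

  reflects-∘ : ∀ {F G} → Reflects F → Reflects G → Reflects (F ∘ᴾ G)
  reflects-∘ {F} {G} rF rG a Fa∈ =
    rG a (rF (apply G a) (InA∅-resp (λ l → sym (apply-∘ F G a l)) Fa∈))

  preserves⇒reflects⁻¹ : ∀ {F} → Preserves F → Reflects (F ⁻¹ᴾ)
  preserves⇒reflects⁻¹ {F} pF a F⁻¹a∈ = InA∅-resp (apply-inverseʳ F a) (pF (apply (F ⁻¹ᴾ) a) F⁻¹a∈)

  reflects⇒preserves⁻¹ : ∀ {F} → Reflects F → Preserves (F ⁻¹ᴾ)
  reflects⇒preserves⁻¹ {F} rF a a∈ = rF (apply (F ⁻¹ᴾ) a) (InA∅-resp (λ l → sym (apply-inverseʳ F a l)) a∈)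

  preserves-constant : ∀ c → Preserves (constant c)
  preserves-constant c a (chain , wrap) =
    (λ j → ℚP.+-monoˡ-≤ (toℚ c) (chain j)) ,
    subst (_≤ a (fromℕ k) + toℚ c) (xy∙z≈xz∙y (a zero) (ℚ.- 1ℚ) (toℚ c)) (ℚP.+-monoˡ-≤ (toℚ c) wrap)

  reflects-constant : ∀ c → Reflects (constant c)
  reflects-constant c a ca∈ =
    InA∅-resp (apply-inverseˡ (constant c) a) (preserves-constant (ℤ.- c) (apply (constant c) a) ca∈)

-- With 0-based indices, s_g swaps
-- the coordinates  down g  and  g , where down is the cyclic predecessor;
-- s_0 moreover adds 1 to coordinate 0 and subtracts 1 from coordinate k.

module _ {k : ℕ} where

  down : Fin (ℕ.suc k) → Fin (ℕ.suc k)
  down zero    = fromℕ k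
  down (suc j) = inject₁ j

  genPerm : Fin (ℕ.suc k) → Fin (ℕ.suc k) → Fin (ℕ.suc k)
  genPerm zero j with j ≟ zero
  ... | yes _ = fromℕ k
  ... | no _ with j ≟ fromℕ k
  ...   | yes _ = zero
  ...   | no _ = j
  genPerm (suc i) j with j ≟ inject₁ i
  ... | yes _ = suc i
  ... | no _ with j ≟ suc i
  ...   | yes _ = inject₁ i
  ...   | no _ = j

  genOffset : Fin (ℕ.suc k) → Fin (ℕ.suc k) → ℤ
  genOffset zero j with j ≟ zero
  ... | yes _ = + 1
  ... | no _ with j ≟ fromℕ k
  ...   | yes _ = ℤ.- + 1
  ...   | no _ = + 0
  genOffset (suc i) j = + 0

  genPerm-left : ∀ g → genPerm g (down g) ≡ g
  genPerm-left zero with fromℕ k ≟ zero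
  ... | yes p = p
  ... | no _ with fromℕ k ≟ fromℕ k
  ...   | yes _ = refl
  ...   | no q = ⊥-elim (q refl)
  genPerm-left (suc i) with inject₁ i ≟ inject₁ i
  ... | yes _ = refl
  ... | no q = ⊥-elim (q refl)

  genPerm-right : ∀ g → genPerm g g ≡ down g
  genPerm-right zero = refl
  genPerm-right (suc i) with suc i ≟ inject₁ i
  ... | yes p = p
  ... | no _ with suc i ≟ suc i
  ...   | yes _ = refl
  ...   | no q = ⊥-elim (q refl)

  genPerm-other : ∀ g j → j ≢ down g → j ≢ g → genPerm g j ≡ j
  genPerm-other zero j j≢down j≢g with j ≟ zero
  ... | yes j≡g = ⊥-elim (j≢g j≡g)
  ... | no _ with j ≟ fromℕ k
  ...   | yes j≡down = ⊥-elim (j≢down j≡down)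
  ...   | no _ = refl
  genPerm-other (suc i) j j≢down j≢g with j ≟ inject₁ i
  ... | yes j≡down = ⊥-elim (j≢down j≡down)
  ... | no _ with j ≟ suc i
  ...   | yes j≡g = ⊥-elim (j≢g j≡g)
  ...   | no _ = refl

  genPerm-involutive : ∀ g j → genPerm g (genPerm g j) ≡ j
  genPerm-involutive g j with j ≟ down g | j ≟ g
  ... | yes refl | _      = trans (cong (genPerm g) (genPerm-left g)) (genPerm-right g)
  ... | no _     | yes refl = trans (cong (genPerm g) (genPerm-right g)) (genPerm-left g)
  ... | no j≢down | no j≢g =
    trans (cong (genPerm g) (genPerm-other g j j≢down j≢g)) (genPerm-other g j j≢down j≢g)

  genOffset-last : fromℕ k ≢ zero → genOffset zero (fromℕ k) ≡ ℤ.- + 1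
  genOffset-last last≢0 with fromℕ k ≟ zero
  ... | yes last≡0 = ⊥-elim (last≢0 last≡0)
  ... | no _ with fromℕ k ≟ fromℕ k
  ...   | yes _ = refl
  ...   | no q  = ⊥-elim (q refl)

  genOffset-other : ∀ j → j ≢ zero → j ≢ fromℕ k → genOffset zero j ≡ + 0
  genOffset-other j j≢0 j≢last with j ≟ zero
  ... | yes j≡0 = ⊥-elim (j≢0 j≡0)
  ... | no _ with j ≟ fromℕ k
  ...   | yes j≡last = ⊥-elim (j≢last j≡last)
  ...   | no _ = refl

  generator : Fin (ℕ.suc k) → PermTransl k
  generator g = record
    { π = genPerm g ; π⁻¹ = genPerm g ; π⁻¹∘π = genPerm-involutive g
    ; π∘π⁻¹ = genPerm-involutive g ; offset = genOffset g }

  gen-apply : ∀ g a → gen g a ≗ apply (generator g) a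
  gen-apply zero a j with j ≟ zero
  ... | yes _ = refl
  ... | no _ with j ≟ fromℕ k
  ...   | yes _ = refl
  ...   | no _ = sym (ℚP.+-identityʳ (a j))
  gen-apply (suc i) a j with j ≟ inject₁ i
  ... | yes _ = sym (ℚP.+-identityʳ _)
  ... | no _ with j ≟ suc i
  ...   | yes _ = sym (ℚP.+-identityʳ _)
  ...   | no _ = sym (ℚP.+-identityʳ _)

  gen-cong : ∀ g {a b : Vect k} → a ≗ b → gen g a ≗ gen g b
  gen-cong g {a} {b} a≗b j = begin
    gen g a j                    ≡⟨ gen-apply g a j ⟩
    apply (generator g) a j      ≡⟨ apply-cong (generator g) a≗b j ⟩
    apply (generator g) b j      ≡⟨ gen-apply g b j ⟨
    gen g b j                    ∎
    where open ≡-Reasoning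

  intertwine-⁻¹ : ∀ F g h → (∀ b → apply F (gen g b) ≗ gen h (apply F b))
                → ∀ a → apply (F ⁻¹ᴾ) (gen h a) ≗ gen g (apply (F ⁻¹ᴾ) a)
  intertwine-⁻¹ F g h F-int a l = begin
    apply (F ⁻¹ᴾ) (gen h a) l                        ≡⟨ apply-cong (F ⁻¹ᴾ) h-a≗F-g l ⟩
    apply (F ⁻¹ᴾ) (apply F (gen g (apply (F ⁻¹ᴾ) a))) l ≡⟨ apply-inverseˡ F (gen g (apply (F ⁻¹ᴾ) a)) l ⟩
    gen g (apply (F ⁻¹ᴾ) a) l                        ∎
    where
    open ≡-Reasoning
    h-a≗F-g : gen h a ≗ apply F (gen g (apply (F ⁻¹ᴾ) a))
    h-a≗F-g j = trans (gen-cong h (λ i → sym (apply-inverseʳ F a i)) j)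
                      (sym (F-int (apply (F ⁻¹ᴾ) a) j))

  constant-gen : ∀ c g a → gen g (apply (constant c) a) ≗ apply (constant c) (gen g a)
  constant-gen c g a l = begin
    gen g (apply (constant c) a) l                    ≡⟨ gen-apply g _ l ⟩
    apply (generator g) (apply (constant c) a) l      ≡⟨ apply-∘ (generator g) (constant c) a l ⟩
    apply (generator g ∘ᴾ constant c) a l             ≡⟨ apply-≈ (generator g ∘ᴾ constant c) (constant c ∘ᴾ generator g)
                                                           ((λ _ → refl) , (λ l → ℤP.+-comm c (genOffset g l))) a l ⟩
    apply (constant c ∘ᴾ generator g) a l             ≡⟨ apply-∘ (constant c) (generator g) a l ⟨
    apply (constant c) (apply (generator g) a) l      ≡⟨ apply-cong (constant c) (gen-apply g a) l ⟨
    apply (constant c) (gen g a) l                    ∎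
    where open ≡-Reasoning

  word : Word k → PermTransl k
  word []      = constant (+ 0)
  word (i ∷ w) = generator i ∘ᴾ word w

  act-apply : ∀ w a → act w a ≗ apply (word w) a
  act-apply [] a j = sym (apply-zero a j)
  act-apply (i ∷ w) a j = begin
    gen i (act w a) j                            ≡⟨ gen-cong i (act-apply w a) j ⟩
    gen i (apply (word w) a) j                   ≡⟨ gen-apply i (apply (word w) a) j ⟩
    apply (generator i) (apply (word w) a) j     ≡⟨ apply-∘ (generator i) (word w) a j ⟩
    apply (word (i ∷ w)) a j                     ∎
    where open ≡-Reasoning

%-absorbˡ : ∀ a b n .{{_ : ℕ.NonZero n}} → (a % n ℕ.+ b) % n ≡ (a ℕ.+ b) % n
%-absorbˡ a b n = begin
  (a % n ℕ.+ b) % n              ≡⟨ %-distribˡ-+ (a % n) b n ⟩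
  (a % n % n ℕ.+ b % n) % n      ≡⟨ cong (λ u → (u ℕ.+ b % n) % n) (m%n%n≡m%n a n) ⟩
  (a % n ℕ.+ b % n) % n          ≡⟨ %-distribˡ-+ a b n ⟨
  (a ℕ.+ b) % n                  ∎
  where open ≡-Reasoning

module _ {k : ℕ} where

  toℕ-shiftIdx : ∀ m (i : Fin (ℕ.suc k)) → toℕ (shiftIdx m i) ≡ (toℕ i ℕ.+ m) % ℕ.suc k
  toℕ-shiftIdx m i = FinP.toℕ-fromℕ< (m%n<n (toℕ i ℕ.+ m) (ℕ.suc k))

  up : Fin (ℕ.suc k) → Fin (ℕ.suc k)
  up = shiftIdx 1

  up-last : up (fromℕ k) ≡ zero
  up-last = FinP.toℕ-injective (begin
    toℕ (up (fromℕ k))              ≡⟨ toℕ-shiftIdx 1 (fromℕ k) ⟩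
    (toℕ (fromℕ k) ℕ.+ 1) % ℕ.suc k ≡⟨ cong (λ u → (u ℕ.+ 1) % ℕ.suc k) (FinP.toℕ-fromℕ k) ⟩
    (k ℕ.+ 1) % ℕ.suc k             ≡⟨ cong (_% ℕ.suc k) (ℕP.+-comm k 1) ⟩
    ℕ.suc k % ℕ.suc k               ≡⟨ n%n≡0 (ℕ.suc k) ⟩
    0                               ∎)
    where open ≡-Reasoning

  up-inject₁ : ∀ j → up (inject₁ j) ≡ suc j
  up-inject₁ j = FinP.toℕ-injective (begin
    toℕ (up (inject₁ j))              ≡⟨ toℕ-shiftIdx 1 (inject₁ j) ⟩
    (toℕ (inject₁ j) ℕ.+ 1) % ℕ.suc k ≡⟨ cong (λ u → (u ℕ.+ 1) % ℕ.suc k) (FinP.toℕ-inject₁ j) ⟩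
    (toℕ j ℕ.+ 1) % ℕ.suc k           ≡⟨ cong (_% ℕ.suc k) (ℕP.+-comm (toℕ j) 1) ⟩
    ℕ.suc (toℕ j) % ℕ.suc k           ≡⟨ m<n⇒m%n≡m (s≤s (FinP.toℕ<n j)) ⟩
    ℕ.suc (toℕ j)                     ∎)
    where open ≡-Reasoning

  up-down : ∀ i → up (down i) ≡ i
  up-down zero    = up-last
  up-down (suc j) = up-inject₁ j

  down-up : ∀ i → down (up i) ≡ i
  down-up i with view i
  ... | ‵fromℕ  = cong down up-last
  ... | ‵inj₁ {i = j} _ = cong down (up-inject₁ j)

  down-injective : ∀ {i j} → down i ≡ down j → i ≡ j
  down-injective {i} {j} eq = trans (sym (up-down i)) (trans (cong up eq) (up-down j))

  rotateIdx : ℕ → Fin (ℕ.suc k) → Fin (ℕ.suc k)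
  rotateIdx ℕ.zero    i = i
  rotateIdx (ℕ.suc s) i = up (rotateIdx s i)

  toℕ-rotateIdx : ∀ s i → toℕ (rotateIdx s i) ≡ (toℕ i ℕ.+ s) % ℕ.suc k
  toℕ-rotateIdx ℕ.zero i = sym (trans (cong (_% ℕ.suc k) (ℕP.+-identityʳ (toℕ i)))
                                      (m<n⇒m%n≡m (FinP.toℕ<n i)))
  toℕ-rotateIdx (ℕ.suc s) i = begin
    toℕ (up (rotateIdx s i))                 ≡⟨ toℕ-shiftIdx 1 (rotateIdx s i) ⟩
    (toℕ (rotateIdx s i) ℕ.+ 1) % ℕ.suc k    ≡⟨ cong (λ u → (u ℕ.+ 1) % ℕ.suc k) (toℕ-rotateIdx s i) ⟩
    ((toℕ i ℕ.+ s) % ℕ.suc k ℕ.+ 1) % ℕ.suc k ≡⟨ %-absorbˡ (toℕ i ℕ.+ s) 1 (ℕ.suc k) ⟩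
    (toℕ i ℕ.+ s ℕ.+ 1) % ℕ.suc k            ≡⟨ cong (_% ℕ.suc k) (trans (ℕP.+-assoc (toℕ i) s 1)
                                                   (cong (toℕ i ℕ.+_) (ℕP.+-comm s 1))) ⟩
    (toℕ i ℕ.+ ℕ.suc s) % ℕ.suc k            ∎
    where open ≡-Reasoning

  rotateIdx-zero : ∀ i → rotateIdx (toℕ i) zero ≡ i
  rotateIdx-zero i = FinP.toℕ-injective (trans (toℕ-rotateIdx (toℕ i) zero) (m<n⇒m%n≡m (FinP.toℕ<n i)))

  -- the permutation part of  ρ ∘ s_{down g} = s_g ∘ ρ  (ρ is the rotation below)
  rotation-conj-perm : ∀ (g l : Fin (ℕ.suc k)) → Dec (l ≡ down g) → Dec (l ≡ g)
                     → genPerm (down g) (down l) ≡ down (genPerm g l)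
  rotation-conj-perm g .(down g) (yes refl) _ =
    trans (genPerm-left (down g)) (sym (cong down (genPerm-left g)))
  rotation-conj-perm g .g (no _) (yes refl) =
    trans (genPerm-right (down g)) (sym (cong down (genPerm-right g)))
  rotation-conj-perm g l (no l≢dg) (no l≢g) =
    trans (genPerm-other (down g) (down l) (λ eq → l≢dg (down-injective eq)) (λ eq → l≢g (down-injective eq)))
          (sym (cong down (genPerm-other g l l≢dg l≢g)))

decreasing-≤-first : ∀ {m} (g : Fin (ℕ.suc m) → ℤ) → (∀ (j : Fin m) → g (suc j) ℤ.≤ g (inject₁ j))
                   → ∀ l → g l ℤ.≤ g zero
decreasing-≤-first {ℕ.zero}  g dec zero = ℤP.≤-refl
decreasing-≤-first {ℕ.suc m} g dec zero = ℤP.≤-refl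
decreasing-≤-first {ℕ.suc m} g dec (suc l) =
  ℤP.≤-trans (decreasing-≤-first (λ j → g (suc j)) (λ j → dec (suc j)) l) (dec zero)

decreasing-last-≤ : ∀ {m} (g : Fin (ℕ.suc m) → ℤ) → (∀ (j : Fin m) → g (suc j) ℤ.≤ g (inject₁ j))
                  → ∀ l → g (fromℕ m) ℤ.≤ g l
decreasing-last-≤ {ℕ.zero}  g dec zero = ℤP.≤-refl
decreasing-last-≤ {ℕ.suc m} g dec zero =
  ℤP.≤-trans (decreasing-last-≤ (λ j → g (suc j)) (λ j → dec (suc j)) zero) (dec zero)
decreasing-last-≤ {ℕ.suc m} g dec (suc l) = decreasing-last-≤ (λ j → g (suc j)) (λ j → dec (suc j)) l

increasing-toℕ : ∀ {m} (f : Fin (ℕ.suc m) → ℕ) → (∀ (j : Fin m) → f (inject₁ j) ℕ.< f (suc j))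
               → f (fromℕ m) ℕ.≤ m → ∀ l → f l ≡ toℕ l
increasing-toℕ {ℕ.zero} f inc bound zero = ℕP.n≤0⇒n≡0 bound
increasing-toℕ {ℕ.suc m} f inc bound l = on-all l
  where
  on-inject₁ : ∀ l → f (inject₁ l) ≡ toℕ l
  on-inject₁ = increasing-toℕ (λ l → f (inject₁ l)) (λ j → inc (inject₁ j))
                 (ℕP.≤-pred (ℕP.≤-trans (inc (fromℕ m)) bound))
  on-last : f (fromℕ (ℕ.suc m)) ≡ ℕ.suc m
  on-last = ℕP.≤-antisym bound (subst (ℕ._< f (fromℕ (ℕ.suc m)))
                                      (trans (on-inject₁ (fromℕ m)) (FinP.toℕ-fromℕ m)) (inc (fromℕ m)))
  on-all : ∀ l → f l ≡ toℕ l
  on-all l with view l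
  ... | ‵fromℕ = trans on-last (sym (FinP.toℕ-fromℕ (ℕ.suc m)))
  ... | ‵inj₁ {i = l′} _ = trans (on-inject₁ l′) (sym (FinP.toℕ-inject₁ l′))

module _ {k′ : ℕ} where
  private
    k : ℕ
    k = ℕ.suc k′
    n : ℕ
    n = ℕ.suc k

  last≢zero : fromℕ k ≢ zero
  last≢zero ()

  -- Every element of W has total shift 0.  For s_0: s_0² = 1 has offsets 0,
  -- so twice the total shift of s_0 vanishes.
  totalShift-generator : ∀ g → totalShift (generator {k} g) ≡ + 0
  totalShift-generator zero = half-zero _ (begin
      totalShift s₀ ℤ.+ totalShift s₀    ≡⟨ totalShift-∘ s₀ s₀ ⟨
      totalShift (s₀ ∘ᴾ s₀)              ≡⟨ sumℤ-cong (λ l → s₀²-offset l (l ≟ zero) (l ≟ fromℕ k)) ⟩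
      totalShift (constant {k} (+ 0))    ≡⟨ totalShift-constant {k} (+ 0) ⟩
      + n ℤ.* + 0                        ≡⟨ ℤP.*-zeroʳ (+ n) ⟩
      + 0                                ∎)
    where
    open ≡-Reasoning
    s₀ : PermTransl k
    s₀ = generator zero
    s₀²-offset : ∀ l → Dec (l ≡ zero) → Dec (l ≡ fromℕ k) → offset (s₀ ∘ᴾ s₀) l ≡ + 0
    s₀²-offset .zero (yes refl) _ = cong (ℤ._+ + 1) (genOffset-last {k} last≢zero)
    s₀²-offset .(fromℕ k) (no _) (yes refl) =
      trans (cong (λ j → genOffset zero j ℤ.+ genOffset zero (fromℕ k)) (genPerm-left {k} zero))
            (cong (λ z → + 1 ℤ.+ z) (genOffset-last {k} last≢zero))
    s₀²-offset l (no l≢0) (no l≢last) =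
      trans (cong (λ j → genOffset zero j ℤ.+ genOffset zero l) (genPerm-other {k} zero l l≢last l≢0))
            (cong (λ z → z ℤ.+ z) (genOffset-other {k} l l≢0 l≢last))
    half-zero : ∀ z → z ℤ.+ z ≡ + 0 → z ≡ + 0
    half-zero (+ 0)       _ = refl
    half-zero ℤ.+[1+ _ ]  ()
    half-zero -[1+ _ ]    ()
  totalShift-generator (suc i) = trans (totalShift-constant {k} (+ 0)) (ℤP.*-zeroʳ (+ n))

  totalShift-word : ∀ w → totalShift (word {k} w) ≡ + 0
  totalShift-word []      = trans (totalShift-constant {k} (+ 0)) (ℤP.*-zeroʳ (+ n))
  totalShift-word (i ∷ w) = begin
    totalShift (generator i ∘ᴾ word w)               ≡⟨ totalShift-∘ (generator i) (word w) ⟩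
    totalShift (word w) ℤ.+ totalShift (generator i) ≡⟨ cong₂ ℤ._+_ (totalShift-word w) (totalShift-generator i) ⟩
    + 0                                              ∎
    where open ≡-Reasoning

  InA∅ℤ : (Fin n → ℤ) → Set
  InA∅ℤ u = (∀ (j : Fin k) → u (suc j) ℤ.≤ u (inject₁ j)) × (u zero ℤ.- + 1 ℤ.≤ u (fromℕ k))

  InA∅ℤ⇒InA∅ : ∀ u → InA∅ℤ u → InA∅ (λ j → toℚ (u j))
  InA∅ℤ⇒InA∅ u (chain , wrap) =
    (λ j → toℚ-mono-≤ (chain j)) , subst (_≤ toℚ (u (fromℕ k))) (toℚ-+ (u zero) (ℤ.- + 1)) (toℚ-mono-≤ wrap)

  InA∅⇒InA∅ℤ : ∀ u → InA∅ (λ j → toℚ (u j)) → InA∅ℤ u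
  InA∅⇒InA∅ℤ u (chain , wrap) =
    (λ j → toℚ-cancel-≤ (chain j)) ,
    toℚ-cancel-≤ (subst (_≤ toℚ (u (fromℕ k))) (sym (toℚ-+ (u zero) (ℤ.- + 1))) wrap)

  preserves-InA∅ℤ : ∀ F → Preserves F → ∀ u → InA∅ℤ u → InA∅ℤ (λ l → u (π F l) ℤ.+ offset F l)
  preserves-InA∅ℤ F F-pres u u∈ = InA∅⇒InA∅ℤ (λ l → u (π F l) ℤ.+ offset F l)
    (InA∅-resp (λ l → sym (toℚ-+ (u (π F l)) (offset F l)))
               (F-pres (λ j → toℚ (u j)) (InA∅ℤ⇒InA∅ u u∈)))

  -- The test points: the vertex vₜ of A∅ has coordinate 1 at the indices ≤ t
  -- and 0 elsewhere.
  indicator : {A : Set} → Dec A → ℤ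
  indicator (yes _) = + 1
  indicator (no _)  = + 0

  vertex : ℕ → Fin n → ℤ
  vertex t p = indicator (toℕ p ℕ.≤? t)

  vertex-InA∅ℤ : ∀ t → InA∅ℤ (vertex t)
  vertex-InA∅ℤ t = (λ j → mono (toℕ (suc j) ℕ.≤? t) (toℕ (inject₁ j) ℕ.≤? t) (smaller j)) ,
                   wrap (toℕ {n} zero ℕ.≤? t) (toℕ (fromℕ k) ℕ.≤? t)
    where
    smaller : ∀ j → toℕ (suc j) ℕ.≤ t → toℕ (inject₁ j) ℕ.≤ t
    smaller j le = subst (ℕ._≤ t) (sym (FinP.toℕ-inject₁ j)) (ℕP.≤-trans (ℕP.n≤1+n _) le)
    mono : ∀ {A B : Set} (A? : Dec A) (B? : Dec B) → (A → B) → indicator A? ℤ.≤ indicator B?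
    mono (yes _) (yes _) _   = ℤP.≤-refl
    mono (yes a) (no ¬b) a→b = ⊥-elim (¬b (a→b a))
    mono (no _)  (yes _) _   = ℤ.+≤+ z≤n
    mono (no _)  (no _)  _   = ℤP.≤-refl
    wrap : ∀ {A B : Set} (A? : Dec A) (B? : Dec B) → indicator A? ℤ.- + 1 ℤ.≤ indicator B?
    wrap (yes _) (yes _) = ℤ.+≤+ z≤n
    wrap (yes _) (no _)  = ℤ.+≤+ z≤n
    wrap (no _)  (yes _) = ℤ.-≤+
    wrap (no _)  (no _)  = ℤ.-≤+

  indicator-yes : ∀ {A : Set} (A? : Dec A) → + 1 ℤ.≤ indicator A? → A
  indicator-yes (yes a) _ = a
  indicator-yes (no _) (ℤ.+≤+ ())

  module _ (F : PermTransl k) (F-pres : Preserves F) (π0 : π F zero ≡ zero) where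
    private
      c : ℤ
      c = offset F zero
      image : ∀ u → InA∅ℤ u → InA∅ℤ (λ l → u (π F l) ℤ.+ offset F l)
      image = preserves-InA∅ℤ F F-pres

      π-injective : ∀ {p q} → π F p ≡ π F q → p ≡ q
      π-injective {p} {q} eq = trans (sym (π⁻¹∘π F p)) (trans (cong (π⁻¹ F) eq) (π⁻¹∘π F q))

      -- the image of 0 shows that the offsets decrease ...
      decreasing : ∀ (j : Fin k) → offset F (suc j) ℤ.≤ offset F (inject₁ j)
      decreasing j = subst₂ ℤ._≤_ (ℤP.+-identityˡ _) (ℤP.+-identityˡ _)
                       (proj₁ (image (λ _ → + 0) ((λ _ → ℤP.≤-refl) , ℤ.-≤+)) j)

      -- ... and the image of v₀ that the last offset is at least the first
      first≤last : c ℤ.≤ offset F (fromℕ k)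
      first≤last = subst₂ ℤ._≤_ lhs rhs (proj₂ (image (vertex 0) (vertex-InA∅ℤ 0)))
        where
        lhs : vertex 0 (π F zero) ℤ.+ c ℤ.- + 1 ≡ c
        lhs rewrite π0 = trans (cong (ℤ._- + 1) (ℤP.+-comm (+ 1) c)) (ℤG.//-rightDividesʳ (+ 1) c)
        π-last≢0 : toℕ (π F (fromℕ k)) ≢ 0
        π-last≢0 eq with π-injective (trans (FinP.toℕ-injective eq) (sym π0))
        ... | ()
        rhs : vertex 0 (π F (fromℕ k)) ℤ.+ offset F (fromℕ k) ≡ offset F (fromℕ k)
        rhs with toℕ (π F (fromℕ k)) ℕ.≤? 0
        ... | yes le = ⊥-elim (π-last≢0 (ℕP.n≤0⇒n≡0 le))
        ... | no _   = ℤP.+-identityˡ _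

    offset-constant : ∀ l → offset F l ≡ offset F zero
    offset-constant l = ℤP.≤-antisym (decreasing-≤-first (offset F) decreasing l)
                          (ℤP.≤-trans first≤last (decreasing-last-≤ (offset F) decreasing l))

    private
      cancel-offset : ∀ {a b} → a ℤ.+ c ℤ.≤ b ℤ.+ c → a ℤ.≤ b
      cancel-offset {a} {b} le =
        subst₂ ℤ._≤_ (ℤG.//-rightDividesʳ c a) (ℤG.//-rightDividesʳ c b) (ℤP.+-monoˡ-≤ (ℤ.- c) le)

      -- the image of vₜ with t = π (j + 1) shows  π j ≤ π (j + 1)
      π-increasing : ∀ (j : Fin k) → toℕ (π F (inject₁ j)) ℕ.< toℕ (π F (suc j))
      π-increasing j = ℕP.≤∧≢⇒< below distinct
        where
        t : ℕ
        t = toℕ (π F (suc j))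
        chain : vertex t (π F (suc j)) ℤ.≤ vertex t (π F (inject₁ j))
        chain = cancel-offset (subst₂ (λ d d′ → vertex t (π F (suc j)) ℤ.+ d ℤ.≤ vertex t (π F (inject₁ j)) ℤ.+ d′)
                                      (offset-constant (suc j)) (offset-constant (inject₁ j))
                                      (proj₁ (image (vertex t) (vertex-InA∅ℤ t)) j))
        at-t : vertex t (π F (suc j)) ≡ + 1
        at-t with t ℕ.≤? t
        ... | yes _ = refl
        ... | no t≰t = ⊥-elim (t≰t ℕP.≤-refl)
        below : toℕ (π F (inject₁ j)) ℕ.≤ t
        below = indicator-yes (toℕ (π F (inject₁ j)) ℕ.≤? t)
                  (subst (ℤ._≤ vertex t (π F (inject₁ j))) at-t chain)
        distinct : toℕ (π F (inject₁ j)) ≢ t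
        distinct eq = ℕP.1+n≢n (sym (trans (sym (FinP.toℕ-inject₁ j))
                        (cong toℕ (π-injective (FinP.toℕ-injective eq)))))

    π-identity : ∀ l → π F l ≡ l
    π-identity l = FinP.toℕ-injective (increasing-toℕ (λ p → toℕ (π F p)) π-increasing
                                         (FinP.toℕ≤pred[n] (π F (fromℕ k))) l)

    stabiliser : F ≈ᴾ constant (offset F zero)
    stabiliser = π-identity , offset-constant

  -- The rotation  ρ : (a_1, …, a_{k+1}) ↦ (a_{k+1} + 1, a_1, …, a_k)  maps A∅ onto
  -- itself, has total shift 1 and conjugates s_i to s_{i+1}.
  -- the offsets of ρ
  atZero : Fin n → ℤ
  atZero zero    = + 1
  atZero (suc _) = + 0

  rotation : PermTransl k
  rotation = record
    { π = down ; π⁻¹ = up ; π⁻¹∘π = up-down ; π∘π⁻¹ = down-up ; offset = atZero }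

  totalShift-rotation : totalShift rotation ≡ + 1
  totalShift-rotation = cong (λ z → + 1 ℤ.+ z) (trans (sumℤ-const k (+ 0)) (ℤP.*-zeroʳ (+ k)))

  preserves-rotation : Preserves rotation
  preserves-rotation a (chain , wrap) = chain′ , wrap′
    where
    chain′ : ∀ (j : Fin k) → apply rotation a (suc j) ≤ apply rotation a (inject₁ j)
    chain′ zero = subst (_≤ a (fromℕ k) + 1ℚ) (trans (//-rightDividesˡ 1ℚ (a zero)) (sym (ℚP.+-identityʳ (a zero))))
                    (ℚP.+-monoˡ-≤ 1ℚ wrap)
    chain′ (suc j) = ℚP.+-monoˡ-≤ (toℚ (+ 0)) (chain (inject₁ j))
    wrap′ : apply rotation a zero - 1ℚ ≤ apply rotation a (fromℕ k)
    wrap′ = subst₂ _≤_ (sym (//-rightDividesʳ 1ℚ (a (fromℕ k)))) (sym (ℚP.+-identityʳ _)) (chain (fromℕ k′))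

  reflects-rotation : Reflects rotation
  reflects-rotation a (chain′ , wrap′) = chain , wrap
    where
    chain : ∀ (j : Fin k) → a (suc j) ≤ a (inject₁ j)
    chain j with view j
    ... | ‵fromℕ = subst₂ _≤_ (//-rightDividesʳ 1ℚ (a (fromℕ k))) (ℚP.+-identityʳ _) wrap′
    ... | ‵inj₁ {i = j′} _ = subst₂ _≤_ (ℚP.+-identityʳ _) (ℚP.+-identityʳ _) (chain′ (suc j′))
    wrap : a zero - 1ℚ ≤ a (fromℕ k)
    wrap = subst (a zero - 1ℚ ≤_) (//-rightDividesʳ 1ℚ (a (fromℕ k)))
             (ℚP.+-monoˡ-≤ (ℚ.- 1ℚ) (subst (_≤ a (fromℕ k) + 1ℚ) (ℚP.+-identityʳ (a zero)) (chain′ zero)))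

  -- The offset part of  ρ ∘ s_{down g} = s_g ∘ ρ ; first for g = 0,
  rotation-conj-offset₀ : ∀ l → Dec (l ≡ zero) → Dec (l ≡ fromℕ k)
                        → atZero l ≡ atZero (genPerm zero l) ℤ.+ genOffset zero l
  rotation-conj-offset₀ .zero (yes refl) _ = refl
  rotation-conj-offset₀ .(fromℕ k) (no _) (yes refl) =
    sym (cong₂ ℤ._+_ (cong atZero (genPerm-left {k} zero)) (genOffset-last {k} last≢zero))
  rotation-conj-offset₀ l (no l≢0) (no l≢last) =
    sym (trans (cong₂ ℤ._+_ (cong atZero (genPerm-other {k} zero l l≢last l≢0)) (genOffset-other {k} l l≢0 l≢last))
               (ℤP.+-identityʳ (atZero l)))

  -- then for g ≠ 0 (where s_{down g} has no offsets), since s_g with g ≠ 0 and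
  -- down g ≠ 0 does not move the index 0.
  atZero-≢0 : ∀ p → p ≢ zero → atZero p ≡ + 0
  atZero-≢0 zero    p≢0 = ⊥-elim (p≢0 refl)
  atZero-≢0 (suc _) _   = refl

  atZero-genPerm : ∀ g l → Dec (l ≡ down g) → Dec (l ≡ g) → g ≢ zero → down g ≢ zero
                 → atZero (genPerm g l) ≡ atZero l
  atZero-genPerm g .(down g) (yes refl) _ g≢0 dg≢0 =
    trans (cong atZero (genPerm-left g)) (trans (atZero-≢0 g g≢0) (sym (atZero-≢0 (down g) dg≢0)))
  atZero-genPerm g .g (no _) (yes refl) g≢0 dg≢0 =
    trans (cong atZero (genPerm-right g)) (trans (atZero-≢0 (down g) dg≢0) (sym (atZero-≢0 g g≢0)))
  atZero-genPerm g l (no l≢dg) (no l≢g) _ _ = cong atZero (genPerm-other g l l≢dg l≢g)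

  rotation-conj-offset : ∀ g l → genOffset (down g) (down l) ℤ.+ atZero l
                                 ≡ atZero (genPerm g l) ℤ.+ genOffset g l
  rotation-conj-offset zero l =
    trans (ℤP.+-identityˡ (atZero l)) (rotation-conj-offset₀ l (l ≟ zero) (l ≟ fromℕ k))
  rotation-conj-offset (suc zero) zero = cong (ℤ._+ + 1) (genOffset-last {k} last≢zero)
  rotation-conj-offset (suc zero) (suc zero) = refl
  rotation-conj-offset (suc zero) (suc (suc l)) =
    cong (ℤ._+ + 0) (genOffset-other {k} (suc (inject₁ l)) (λ ())
                       (λ eq → FinP.fromℕ≢inject₁ (sym (FinP.suc-injective eq))))
  rotation-conj-offset g@(suc (suc i)) l = begin
    + 0 ℤ.+ atZero l                      ≡⟨ ℤP.+-identityˡ (atZero l) ⟩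
    atZero l                              ≡⟨ atZero-genPerm g l (l ≟ down g) (l ≟ g) (λ ()) (λ ()) ⟨
    atZero (genPerm g l)                  ≡⟨ ℤP.+-identityʳ _ ⟨
    atZero (genPerm g l) ℤ.+ + 0          ∎
    where open ≡-Reasoning

  rotation-conj : ∀ g → (rotation ∘ᴾ generator (down g)) ≈ᴾ (generator g ∘ᴾ rotation)
  rotation-conj g = (λ l → rotation-conj-perm g l (l ≟ down g) (l ≟ g)) , rotation-conj-offset g

  rotation-gen : ∀ g a → apply rotation (gen g a) ≗ gen (up g) (apply rotation a)
  rotation-gen g a l = begin
    apply ρ (gen g a) l                        ≡⟨ apply-cong ρ (gen-apply g a) l ⟩
    apply ρ (apply (generator g) a) l          ≡⟨ apply-∘ ρ (generator g) a l ⟩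
    apply (ρ ∘ᴾ generator g) a l               ≡⟨ apply-≈ (ρ ∘ᴾ generator g) (generator (up g) ∘ᴾ ρ) conj a l ⟩
    apply (generator (up g) ∘ᴾ ρ) a l          ≡⟨ apply-∘ (generator (up g)) ρ a l ⟨
    apply (generator (up g)) (apply ρ a) l     ≡⟨ gen-apply (up g) (apply ρ a) l ⟨
    gen (up g) (apply ρ a) l                   ∎
    where
    open ≡-Reasoning
    ρ : PermTransl k
    ρ = rotation
    conj : (ρ ∘ᴾ generator g) ≈ᴾ (generator (up g) ∘ᴾ ρ)
    conj = subst (λ h → (ρ ∘ᴾ generator h) ≈ᴾ (generator (up g) ∘ᴾ ρ)) (down-up g) (rotation-conj (up g))

  unrotate : ℕ → PermTransl k
  unrotate ℕ.zero    = constant (+ 0)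
  unrotate (ℕ.suc s) = unrotate s ∘ᴾ rotation ⁻¹ᴾ

  π-unrotate : ∀ s l → π (unrotate s) l ≡ rotateIdx s l
  π-unrotate ℕ.zero    l = refl
  π-unrotate (ℕ.suc s) l = cong up (π-unrotate s l)

  totalShift-unrotate : ∀ s → totalShift (unrotate s) ≡ ℤ.- + s
  totalShift-unrotate ℕ.zero = trans (totalShift-constant {k} (+ 0)) (ℤP.*-zeroʳ (+ n))
  totalShift-unrotate (ℕ.suc s) = begin
    totalShift (unrotate s ∘ᴾ rotation ⁻¹ᴾ)                   ≡⟨ totalShift-∘ (unrotate s) (rotation ⁻¹ᴾ) ⟩
    totalShift (rotation ⁻¹ᴾ) ℤ.+ totalShift (unrotate s)     ≡⟨ cong₂ ℤ._+_ (trans (totalShift-⁻¹ rotation)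
                                                                    (cong ℤ.-_ totalShift-rotation))
                                                                  (totalShift-unrotate s) ⟩
    ℤ.- + 1 ℤ.+ ℤ.- + s                                       ≡⟨ ℤP.neg-distrib-+ (+ 1) (+ s) ⟨
    ℤ.- (+ 1 ℤ.+ + s)                                         ∎
    where open ≡-Reasoning

  preserves-unrotate : ∀ s → Preserves (unrotate s)
  preserves-unrotate ℕ.zero    = preserves-constant (+ 0)
  preserves-unrotate (ℕ.suc s) =
    preserves-∘ {F = unrotate s} {G = rotation ⁻¹ᴾ} (preserves-unrotate s)
                (reflects⇒preserves⁻¹ {F = rotation} reflects-rotation)

  reflects-unrotate : ∀ s → Reflects (unrotate s)
  reflects-unrotate ℕ.zero    = reflects-constant (+ 0)
  reflects-unrotate (ℕ.suc s) =
    reflects-∘ {F = unrotate s} {G = rotation ⁻¹ᴾ} (reflects-unrotate s)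
               (preserves⇒reflects⁻¹ {F = rotation} preserves-rotation)

  unrotate-gen : ∀ s g a → apply (unrotate s) (gen (rotateIdx s g) a) ≗ gen g (apply (unrotate s) a)
  unrotate-gen ℕ.zero g a l =
    trans (apply-zero (gen g a) l) (gen-cong g (λ j → sym (apply-zero a j)) l)
  unrotate-gen (ℕ.suc s) g a l = begin
    apply (U ∘ᴾ ρ⁻¹) (gen (up (rotateIdx s g)) a) l     ≡⟨ apply-∘ U ρ⁻¹ (gen (up (rotateIdx s g)) a) l ⟨
    apply U (apply ρ⁻¹ (gen (up (rotateIdx s g)) a)) l  ≡⟨ apply-cong U (ρ⁻¹-gen (rotateIdx s g) a) l ⟩
    apply U (gen (rotateIdx s g) (apply ρ⁻¹ a)) l       ≡⟨ unrotate-gen s g (apply ρ⁻¹ a) l ⟩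
    gen g (apply U (apply ρ⁻¹ a)) l                     ≡⟨ gen-cong g (apply-∘ U ρ⁻¹ a) l ⟩
    gen g (apply (U ∘ᴾ ρ⁻¹) a) l                        ∎
    where
    open ≡-Reasoning
    U ρ⁻¹ : PermTransl k
    U = unrotate s
    ρ⁻¹ = rotation ⁻¹ᴾ
    ρ⁻¹-gen : ∀ h b → apply ρ⁻¹ (gen (up h) b) ≗ gen h (apply ρ⁻¹ b)
    ρ⁻¹-gen h = intertwine-⁻¹ rotation h (up h) (rotation-gen h)

  rotate-undoes-shift : ∀ z s c → + n ℤ.* c ≡ ℤ.- z ℤ.+ ℤ.- + s
                      → ∀ i → rotateIdx s (shiftIdx (z %ℕ n) i) ≡ i
  rotate-undoes-shift z s c n·c≡ i = FinP.toℕ-injective (begin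
      toℕ (rotateIdx s (shiftIdx m i))      ≡⟨ toℕ-rotateIdx s (shiftIdx m i) ⟩
      (toℕ (shiftIdx m i) ℕ.+ s) % n        ≡⟨ cong (λ u → (u ℕ.+ s) % n) (toℕ-shiftIdx m i) ⟩
      ((toℕ i ℕ.+ m) % n ℕ.+ s) % n         ≡⟨ %-absorbˡ (toℕ i ℕ.+ m) s n ⟩
      (toℕ i ℕ.+ m ℕ.+ s) % n               ≡⟨ cong (_% n) (ℕP.+-assoc (toℕ i) m s) ⟩
      (toℕ i ℕ.+ (m ℕ.+ s)) % n             ≡⟨ cong (λ u → (toℕ i ℕ.+ u) % n) (proj₂ m+s-multiple) ⟩
      (toℕ i ℕ.+ proj₁ m+s-multiple ℕ.* n) % n ≡⟨ [m+kn]%n≡m%n (toℕ i) (proj₁ m+s-multiple) n ⟩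
      toℕ i % n                             ≡⟨ m<n⇒m%n≡m (FinP.toℕ<n i) ⟩
      toℕ i                                 ∎)
    where
    open ≡-Reasoning
    m : ℕ
    m = z %ℕ n
    q : ℤ
    q = z /ℕ n
    ring₁ : ∀ C Q N → (ℤ.- C ℤ.- Q) ℤ.* N ≡ ℤ.- (N ℤ.* C) ℤ.- Q ℤ.* N
    ring₁ = solve-∀
    ring₂ : ∀ M S Q N → ℤ.- (ℤ.- (M ℤ.+ Q ℤ.* N) ℤ.+ ℤ.- S) ℤ.- Q ℤ.* N ≡ M ℤ.+ S
    ring₂ = solve-∀
    -- m + s is an integer multiple of n ...
    m+s≡ : + (m ℕ.+ s) ≡ (ℤ.- c ℤ.- q) ℤ.* + n
    m+s≡ = sym (begin
      (ℤ.- c ℤ.- q) ℤ.* + n                                  ≡⟨ ring₁ c q (+ n) ⟩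
      ℤ.- (+ n ℤ.* c) ℤ.- q ℤ.* + n                          ≡⟨ cong (λ u → ℤ.- u ℤ.- q ℤ.* + n) n·c≡ ⟩
      ℤ.- (ℤ.- z ℤ.+ ℤ.- + s) ℤ.- q ℤ.* + n                  ≡⟨ cong (λ u → ℤ.- (ℤ.- u ℤ.+ ℤ.- + s) ℤ.- q ℤ.* + n)
                                                                     (a≡a%ℕn+[a/ℕn]*n z n) ⟩
      ℤ.- (ℤ.- (+ m ℤ.+ q ℤ.* + n) ℤ.+ ℤ.- + s) ℤ.- q ℤ.* + n ≡⟨ ring₂ (+ m) (+ s) q (+ n) ⟩
      + m ℤ.+ + s                                            ≡⟨ ℤP.pos-+ m s ⟨
      + (m ℕ.+ s)                                            ∎)
    -- ... hence, being non-negative, a natural multiple of n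
    natural-multiple : ∀ a w → + a ≡ w ℤ.* + n → Σ ℕ (λ t → a ≡ t ℕ.* n)
    natural-multiple a (+ t)     eq = t , ℤP.+-injective (trans eq (sym (ℤP.pos-* t n)))
    natural-multiple a -[1+ t ] ()
    m+s-multiple : Σ ℕ (λ t → m ℕ.+ s ≡ t ℕ.* n)
    m+s-multiple = natural-multiple (m ℕ.+ s) (ℤ.- c ℤ.- q) m+s≡

  -- The hypothesis A_x = A_y + η says that  h = y ∘ τ_{-η} ∘ x⁻¹  (with τ_{-η}
  -- the translation by -η) maps A∅ into itself; h sends x ◇ b to y ◇ (b - η).
  alcoveMap : Word k → Word k → Weight k → PermTransl k
  alcoveMap x y η = word y ∘ᴾ translation (λ j → ℤ.- η j) ∘ᴾ word x ⁻¹ᴾ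

  alcoveMap-act : ∀ x y η b → act y (λ j → b j - toℚ (η j)) ≗ apply (alcoveMap x y η) (act x b)
  alcoveMap-act x y η b l = begin
    act y (λ j → b j - toℚ (η j)) l                  ≡⟨ act-apply y _ l ⟩
    apply Y (λ j → b j - toℚ (η j)) l                ≡⟨ apply-cong Y b-η l ⟩
    apply Y (apply (T ∘ᴾ X ⁻¹ᴾ) (act x b)) l         ≡⟨ apply-∘ Y (T ∘ᴾ X ⁻¹ᴾ) (act x b) l ⟩
    apply (alcoveMap x y η) (act x b) l              ∎
    where
    open ≡-Reasoning
    X Y T : PermTransl k
    X = word x
    Y = word y
    T = translation (λ j → ℤ.- η j)
    b-η : (λ j → b j - toℚ (η j)) ≗ apply (T ∘ᴾ X ⁻¹ᴾ) (act x b)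
    b-η j = begin
      b j - toℚ (η j)                       ≡⟨ cong (λ q → b j + q) (toℚ-neg (η j)) ⟨
      apply T b j                           ≡⟨ apply-cong T (λ i → trans (apply-cong (X ⁻¹ᴾ) (act-apply x b) i)
                                                                     (apply-inverseˡ X b i)) j ⟨
      apply T (apply (X ⁻¹ᴾ) (act x b)) j   ≡⟨ apply-∘ T (X ⁻¹ᴾ) (act x b) j ⟩
      apply (T ∘ᴾ X ⁻¹ᴾ) (act x b) j        ∎

  preserves-alcoveMap : ∀ {x y η} → AlcTransl x y η → Preserves (alcoveMap x y η)
  preserves-alcoveMap {x} {y} {η} hyp a a∈ =
    InA∅-resp (λ l → trans (alcoveMap-act x y η b l) (apply-cong (alcoveMap x y η) xb≗a l))
              (proj₁ (hyp b) (InA∅-resp (λ l → sym (xb≗a l)) a∈))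
    where
    b : Vect k
    b = apply (word x ⁻¹ᴾ) a
    xb≗a : act x b ≗ a
    xb≗a l = trans (act-apply x b l) (apply-inverseʳ (word x) a l)

  totalShift-alcoveMap : ∀ x y η → totalShift (alcoveMap x y η) ≡ ℤ.- sumℤ η
  totalShift-alcoveMap x y η = begin
    totalShift (Y ∘ᴾ T ∘ᴾ X ⁻¹ᴾ)                                ≡⟨ totalShift-∘ Y (T ∘ᴾ X ⁻¹ᴾ) ⟩
    totalShift (T ∘ᴾ X ⁻¹ᴾ) ℤ.+ totalShift Y                   ≡⟨ cong₂ ℤ._+_ (totalShift-∘ T (X ⁻¹ᴾ)) (totalShift-word y) ⟩
    totalShift (X ⁻¹ᴾ) ℤ.+ totalShift T ℤ.+ + 0               ≡⟨ ℤP.+-identityʳ _ ⟩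
    totalShift (X ⁻¹ᴾ) ℤ.+ totalShift T                        ≡⟨ cong₂ ℤ._+_ (trans (totalShift-⁻¹ X) (cong ℤ.-_ (totalShift-word x)))
                                                                               (sumℤ-neg η) ⟩
    + 0 ℤ.+ ℤ.- sumℤ η                                         ≡⟨ ℤP.+-identityˡ _ ⟩
    ℤ.- sumℤ η                                                 ∎
    where
    open ≡-Reasoning
    X Y T : PermTransl k
    X = word x
    Y = word y
    T = translation (λ j → ℤ.- η j)

  -- Unrotating h by s = π⁻¹ h 0 fixes the index 0, so by the
  -- stabiliser lemma it is a translation along (c, …, c); comparing total
  -- shifts gives s ≡ -m (mod k+1), so the unrotation conjugates s_i to s_{i+m}.
  module OneLetter (x y : Word k) (η : Weight k) (hyp : AlcTransl x y η) where
    private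
      h : PermTransl k
      h = alcoveMap x y η
      s : ℕ
      s = toℕ (π⁻¹ h zero)
      h₀ : PermTransl k
      h₀ = unrotate s ∘ᴾ h

      h₀-fixes-zero : π h₀ zero ≡ zero
      h₀-fixes-zero = begin
        π h (π (unrotate s) zero)   ≡⟨ cong (π h) (π-unrotate s zero) ⟩
        π h (rotateIdx s zero)      ≡⟨ cong (π h) (rotateIdx-zero (π⁻¹ h zero)) ⟩
        π h (π⁻¹ h zero)            ≡⟨ π∘π⁻¹ h zero ⟩
        zero                        ∎
        where open ≡-Reasoning

      h₀-preserves : Preserves h₀
      h₀-preserves = preserves-∘ {F = unrotate s} {G = h} (preserves-unrotate s)
                                 (preserves-alcoveMap {x = x} {y} {η} hyp)

      c : ℤ
      c = offset h₀ zero

      h₀≈c : h₀ ≈ᴾ constant c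
      h₀≈c = stabiliser h₀ h₀-preserves h₀-fixes-zero

      n·c≡ : + n ℤ.* c ≡ ℤ.- sumℤ η ℤ.+ ℤ.- + s
      n·c≡ = begin
        + n ℤ.* c                                   ≡⟨ totalShift-constant {k} c ⟨
        totalShift (constant {k} c)                 ≡⟨ sumℤ-cong (proj₂ h₀≈c) ⟨
        totalShift h₀                               ≡⟨ totalShift-∘ (unrotate s) h ⟩
        totalShift h ℤ.+ totalShift (unrotate s)    ≡⟨ cong₂ ℤ._+_ (totalShift-alcoveMap x y η) (totalShift-unrotate s) ⟩
        ℤ.- sumℤ η ℤ.+ ℤ.- + s                      ∎
        where open ≡-Reasoning

      key : ∀ i b → apply (unrotate s) (gen i (act y (λ j → b j - toℚ (η j))))
                    ≗ apply (constant c) (gen (shiftIdx (label η) i) (act x b))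
      key i b l = begin
        apply U (gen i (act y (λ j → b j - toℚ (η j)))) l ≡⟨ apply-cong U (gen-cong i (alcoveMap-act x y η b)) l ⟩
        apply U (gen i (apply h a)) l                    ≡⟨ cong (λ g → apply U (gen g (apply h a)) l)
                                                                 (rotate-undoes-shift (sumℤ η) s c n·c≡ i) ⟨
        apply U (gen (rotateIdx s i′) (apply h a)) l     ≡⟨ unrotate-gen s i′ (apply h a) l ⟩
        gen i′ (apply U (apply h a)) l                   ≡⟨ gen-cong i′ (λ j → trans (apply-∘ U h a j)
                                                              (apply-≈ h₀ (constant c) h₀≈c a j)) l ⟩
        gen i′ (apply (constant c) a) l                  ≡⟨ constant-gen c i′ a l ⟩
        apply (constant c) (gen i′ a) l                  ∎
        where
        open ≡-Reasoning
        U : PermTransl k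
        U = unrotate s
        a : Vect k
        a = act x b
        i′ : Fin n
        i′ = shiftIdx (label η) i

    step : ∀ i → AlcTransl (shiftIdx (label η) i ∷ x) (i ∷ y) η
    step i b =
      (λ i′x∈ → reflects-unrotate s (gen i y-side) (InA∅-resp (λ l → sym (key i b l))
                   (preserves-constant c (gen i′ (act x b)) i′x∈))) ,
      (λ iy∈ → reflects-constant c (gen i′ (act x b)) (InA∅-resp (key i b)
                   (preserves-unrotate s (gen i y-side) iy∈)))
      where
      i′ : Fin n
      i′ = shiftIdx (label η) i
      y-side : Vect k
      y-side = act y (λ j → b j - toℚ (η j))

lemma3p5 : (k : ℕ) → 1 ℕ.≤ k → (x y : Word k) → (η : Weight k)
    → AlcTransl x y η
    → (w : Word k) → AlcTransl (shiftW (label η) w ++ x) (w ++ y) η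
lemma3p5 ℕ.zero () x y η hyp w
lemma3p5 (ℕ.suc k′) _ x y η hyp [] = hyp
lemma3p5 (ℕ.suc k′) 1≤k x y η hyp (i ∷ w) =
  OneLetter.step (shiftW (label η) w ++ x) (w ++ y) η (lemma3p5 (ℕ.suc k′) 1≤k x y η hyp w) i
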